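{- Let $D,D'$ be digraphs on the same set of $n$ vertices and let $r\ge0$ be an integer. Assume $\Delta^+(D')\le r$ or $\Delta^-(D')\le r$. Then $\alpha(D\setminus D')\le(2r+1)\alpha(D)$.
   Context: $D\setminus D'$ is the digraph on the common vertex set with edge set $E(D)\setminus E(D')$. $\alpha$ of a digraph is the independence number of its underlying undirected graph; $\Delta^+,\Delta^-$ denote maximum out-degree and in-degree. -}

module Defs where

open import Data.Nat using (ℕ; _≤_)
open import Data.Bool using (Bool; true; false; _∧_; not)
open import Data.Fin using (Fin)
open import Data.Fin.Subset using (Subset; _∈_; ∣_∣)
open import Data.Vec using (count; allFin)
open import Data.Product using (Σ; _×_)
open import Relation.Binary.PropositionalEquality using (_≡_; refl)
open import Relation.Nullary using (¬_)
open import Data.Bool.Properties using (T?)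
open import Data.Bool using (T)

record Digraph (n : ℕ) : Set where
  field
    adj     : Fin n → Fin n → Bool
    loopless : ∀ v → adj v v ≡ false
open Digraph public

_∖_ : ∀ {n} → Digraph n → Digraph n → Digraph n
adj (D ∖ D') u v = adj D u v ∧ not (adj D' u v)
loopless (D ∖ D') v rewrite loopless D v = refl

outdeg : ∀ {n} → Digraph n → Fin n → ℕ
outdeg D v = count (λ u → T? (adj D v u)) (allFin _)

indeg : ∀ {n} → Digraph n → Fin n → ℕ
indeg D v = count (λ u → T? (adj D u v)) (allFin _)

MaxOutdeg≤ : ∀ {n} → Digraph n → ℕ → Set
MaxOutdeg≤ D r = ∀ v → outdeg D v ≤ r

MaxIndeg≤ : ∀ {n} → Digraph n → ℕ → Set
MaxIndeg≤ D r = ∀ v → indeg D v ≤ r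

Independent : ∀ {n} → Digraph n → Subset n → Set
Independent D S = ∀ u v → u ∈ S → v ∈ S → adj D u v ≡ false

IsIndependenceNumber : ∀ {n} → Digraph n → ℕ → Set
IsIndependenceNumber D k =
  Σ (Subset _) (λ S → Independent D S × ∣ S ∣ ≡ k)
  × (∀ S → Independent D S → ∣ S ∣ ≤ k)

-- Let S be a maximum independent set of D ∖ D'. Every arc of D inside S is an
-- arc of D', so it suffices to find inside S an independent set of D' with at
-- least ∣S∣/(2r+1) elements. If Δ⁺(D') ≤ r or Δ⁻(D') ≤ r, every vertex set T
-- spans at most r∣T∣ arcs of D', so the underlying graph of D'[T] has average
-- degree at most 2r. Greedily keep a vertex of degree at most 2r, discard its
-- closed neighbourhood (at most 2r+1 vertices) and recurse.

module Submission where

open import Defs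
open import Data.Nat using (ℕ; _≤_; _*_; _+_; suc)
open import Data.Sum using (_⊎_)

import Algebra.Properties.Semiring.Sum
open import Data.Bool using (Bool; true; false; _∧_; not)
open import Data.Bool.Properties using (T?; ∧-assoc; ∧-comm; ∧-identityʳ; ¬-not)
open import Data.Fin as Fin using (Fin)
open import Data.Fin.Properties using (any?)
open import Data.Fin.Subset
  using (Subset; inside; outside; ⊥; ⁅_⁆; _∪_; _∩_; _─_; _-_; _∈_; _∉_; _⊆_; _⊂_; ∣_∣; Nonempty)
open import Data.Fin.Subset.Properties
  using ( _∈?_; nonempty?; Empty-unique; ∣⊥∣≡0; ∉⊥; ⊥⊆; ∣p∣≤∣x∷p∣; ∣p∩q∣≤∣q∣; ∣⁅x⁆∣≡1; x∈⁅x⁆; x∈⁅y⁆⇒x≡y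
        ; x∈p∪q⁺; x∈p∪q⁻; x∈p∩q⁺; ∩-distribˡ-∪; p─q⊆p; p∩q≢∅⇒p─q⊂p; x∈p∧x≢y⇒x∈p-y
        ; x∈p⇒∣p-x∣<∣p∣; p⊆q⇒∣p∣≤∣q∣)
open import Data.Fin.Subset.Induction using (Acc; acc; ⊂-wellFounded)
open import Data.Nat using (zero; _<_; z≤n; s≤s)
open import Data.Nat.Properties
open import Data.Product using (∃-syntax; _×_; _,_; proj₁; proj₂)
open import Data.Sum using (inj₁; inj₂; [_,_])
open import Data.Vec using (Vec; []; _∷_; there; count; allFin; tabulate; lookup; map)
open import Data.Vec.Properties using (lookup⇒[]=; lookup∘tabulate; lookup-zipWith; tabulate-∘)
open import Function using (_∘_; id)
open import Relation.Binary.PropositionalEquality using (_≡_; refl; sym; trans; cong; cong₂; subst; module ≡-Reasoning)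
open import Relation.Nullary using (yes; no; contradiction; _×-dec_)

open Algebra.Properties.Semiring.Sum +-*-semiring
  using (sum-syntax; sum-cong-≗; ∑-comm; ∑-distrib-+; *-distribˡ-sum)

𝟙 : Bool → ℕ
𝟙 false = 0
𝟙 true  = 1

𝟙-∧ : ∀ a b → 𝟙 (a ∧ b) ≡ 𝟙 a * 𝟙 b
𝟙-∧ false b = refl
𝟙-∧ true  b = sym (+-identityʳ (𝟙 b))

∑-mono-≤ : ∀ {n} {f g : Fin n → ℕ} → (∀ i → f i ≤ g i) → ∑[ i < n ] f i ≤ ∑[ i < n ] g i
∑-mono-≤ {zero}  f≤g = z≤n
∑-mono-≤ {suc n} f≤g = +-mono-≤ (f≤g Fin.zero) (∑-mono-≤ (f≤g ∘ Fin.suc))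

∣p∣≡∑𝟙 : ∀ {n} (p : Subset n) → ∣ p ∣ ≡ ∑[ i < n ] 𝟙 (lookup p i)
∣p∣≡∑𝟙 []            = refl
∣p∣≡∑𝟙 (inside  ∷ p) = cong suc (∣p∣≡∑𝟙 p)
∣p∣≡∑𝟙 (outside ∷ p) = ∣p∣≡∑𝟙 p

∑𝟙*c≡c*∣p∣ : ∀ {n} (p : Subset n) c → ∑[ i < n ] (𝟙 (lookup p i) * c) ≡ c * ∣ p ∣
∑𝟙*c≡c*∣p∣ {n} p c = begin
  ∑[ i < n ] (𝟙 (lookup p i) * c) ≡⟨ sum-cong-≗ (λ i → *-comm (𝟙 (lookup p i)) c) ⟩
  ∑[ i < n ] (c * 𝟙 (lookup p i)) ≡⟨ *-distribˡ-sum c (𝟙 ∘ lookup p) ⟨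
  c * ∑[ i < n ] 𝟙 (lookup p i)   ≡⟨ cong (c *_) (∣p∣≡∑𝟙 p) ⟨
  c * ∣ p ∣                       ∎
  where open ≡-Reasoning

∣p∩tabulate∣≡∑ : ∀ {n} (p : Subset n) (f : Fin n → Bool) →
                 ∣ p ∩ tabulate f ∣ ≡ ∑[ i < n ] 𝟙 (lookup p i ∧ f i)
∣p∩tabulate∣≡∑ p f = trans (∣p∣≡∑𝟙 (p ∩ tabulate f)) (sum-cong-≗ λ i → cong 𝟙
  (trans (lookup-zipWith _∧_ i p (tabulate f)) (cong (lookup p i ∧_) (lookup∘tabulate f i))))

∣p∪q∣≤∣p∣+∣q∣ : ∀ {n} (p q : Subset n) → ∣ p ∪ q ∣ ≤ ∣ p ∣ + ∣ q ∣
∣p∪q∣≤∣p∣+∣q∣ []            []            = z≤n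
∣p∪q∣≤∣p∣+∣q∣ (inside  ∷ p) (x       ∷ q) =
  s≤s (≤-trans (∣p∪q∣≤∣p∣+∣q∣ p q) (+-monoʳ-≤ ∣ p ∣ (∣p∣≤∣x∷p∣ x q)))
∣p∪q∣≤∣p∣+∣q∣ (outside ∷ p) (inside  ∷ q) =
  ≤-trans (s≤s (∣p∪q∣≤∣p∣+∣q∣ p q)) (≤-reflexive (sym (+-suc ∣ p ∣ ∣ q ∣)))
∣p∪q∣≤∣p∣+∣q∣ (outside ∷ p) (outside ∷ q) = ∣p∪q∣≤∣p∣+∣q∣ p q

∣p∣≤∣p─q∣+∣q∣ : ∀ {n} (p q : Subset n) → ∣ p ∣ ≤ ∣ p ─ q ∣ + ∣ q ∣
∣p∣≤∣p─q∣+∣q∣ []            []            = z≤n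
∣p∣≤∣p─q∣+∣q∣ (inside  ∷ p) (outside ∷ q) = s≤s (∣p∣≤∣p─q∣+∣q∣ p q)
∣p∣≤∣p─q∣+∣q∣ (outside ∷ p) (outside ∷ q) = ∣p∣≤∣p─q∣+∣q∣ p q
∣p∣≤∣p─q∣+∣q∣ (inside  ∷ p) (inside  ∷ q) =
  ≤-trans (s≤s (∣p∣≤∣p─q∣+∣q∣ p q)) (≤-reflexive (sym (+-suc ∣ p ─ q ∣ ∣ q ∣)))
∣p∣≤∣p─q∣+∣q∣ (outside ∷ p) (inside  ∷ q) =
  ≤-trans (∣p∣≤∣p─q∣+∣q∣ p q) (+-monoʳ-≤ ∣ p ─ q ∣ (n≤1+n ∣ q ∣))

x∈p─q⇒x∉q : ∀ {n} {x : Fin n} {p q : Subset n} → x ∈ p ─ q → x ∉ q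
x∈p─q⇒x∉q {p = _ ∷ _} {q = _ ∷ _} (there x∈p─q) (there x∈q) = x∈p─q⇒x∉q x∈p─q x∈q

x∈tabulate⁺ : ∀ {n} {f : Fin n → Bool} {x} → f x ≡ true → x ∈ tabulate f
x∈tabulate⁺ {f = f} {x} fx = lookup⇒[]= x (tabulate f) (trans (lookup∘tabulate f x) fx)

count-T?≡∣map∣ : ∀ {a} {A : Set a} {n} (f : A → Bool) (xs : Vec A n) → count (T? ∘ f) xs ≡ ∣ map f xs ∣
count-T?≡∣map∣ f []       = refl
count-T?≡∣map∣ f (x ∷ xs) with f x
... | true  = cong suc (count-T?≡∣map∣ f xs)
... | false = count-T?≡∣map∣ f xs

reverse : ∀ {n} → Digraph n → Digraph n
adj      (reverse G) u v = adj G v u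
loopless (reverse G)     = loopless G

N⁺ N⁻ N : ∀ {n} → Digraph n → Fin n → Subset n
N⁺ G v = tabulate (adj G v)
N⁻ G   = N⁺ (reverse G)
N  G v = N⁺ G v ∪ N⁻ G v

∉N⇒nonadjacent : ∀ {n} (G : Digraph n) {v w} → w ∉ N G v → adj G v w ≡ false × adj G w v ≡ false
∉N⇒nonadjacent G w∉N =
  ¬-not (w∉N ∘ x∈p∪q⁺ ∘ inj₁ ∘ x∈tabulate⁺) , ¬-not (w∉N ∘ x∈p∪q⁺ ∘ inj₂ ∘ x∈tabulate⁺)

outdeg≡∣N⁺∣ : ∀ {n} (G : Digraph n) v → outdeg G v ≡ ∣ N⁺ G v ∣
outdeg≡∣N⁺∣ G v =
  trans (count-T?≡∣map∣ (adj G v) (allFin _)) (cong ∣_∣ (sym (tabulate-∘ (adj G v) id)))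

arcs : ∀ {n} → Digraph n → Subset n → ℕ
arcs {n} G T = ∑[ v < n ] ∑[ w < n ] 𝟙 (lookup T v ∧ lookup T w ∧ adj G v w)

Sparse : ∀ {n} → Digraph n → ℕ → Set
Sparse G r = ∀ T → arcs G T ≤ r * ∣ T ∣

arcs≡∑∣T∩N⁺∣ : ∀ {n} (G : Digraph n) T → arcs G T ≡ ∑[ v < n ] (𝟙 (lookup T v) * ∣ T ∩ N⁺ G v ∣)
arcs≡∑∣T∩N⁺∣ {n} G T = sum-cong-≗ λ v → begin
  ∑[ w < n ] 𝟙 (lookup T v ∧ lookup T w ∧ adj G v w)
    ≡⟨ sum-cong-≗ (λ w → 𝟙-∧ (lookup T v) (lookup T w ∧ adj G v w)) ⟩
  ∑[ w < n ] (𝟙 (lookup T v) * 𝟙 (lookup T w ∧ adj G v w))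
    ≡⟨ *-distribˡ-sum (𝟙 (lookup T v)) (λ w → 𝟙 (lookup T w ∧ adj G v w)) ⟨
  𝟙 (lookup T v) * ∑[ w < n ] 𝟙 (lookup T w ∧ adj G v w)
    ≡⟨ cong (𝟙 (lookup T v) *_) (∣p∩tabulate∣≡∑ T (adj G v)) ⟨
  𝟙 (lookup T v) * ∣ T ∩ N⁺ G v ∣
    ∎
  where open ≡-Reasoning

arcs-reverse : ∀ {n} (G : Digraph n) T → arcs (reverse G) T ≡ arcs G T
arcs-reverse {n} G T = trans
  (∑-comm {n} {n} λ v w → 𝟙 (lookup T v ∧ lookup T w ∧ adj G w v))
  (sum-cong-≗ λ w → sum-cong-≗ λ v → cong 𝟙 (∧-swap (lookup T v) (lookup T w) (adj G w v)))
  where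
  ∧-swap : ∀ x y z → x ∧ y ∧ z ≡ y ∧ x ∧ z
  ∧-swap x y z = trans (sym (∧-assoc x y z)) (trans (cong (_∧ z) (∧-comm x y)) (∧-assoc y x z))

maxOutdeg⇒sparse : ∀ {n} (G : Digraph n) {r} → MaxOutdeg≤ G r → Sparse G r
maxOutdeg⇒sparse {n} G {r} Δ⁺≤r T = begin
  arcs G T                                      ≡⟨ arcs≡∑∣T∩N⁺∣ G T ⟩
  ∑[ v < n ] (𝟙 (lookup T v) * ∣ T ∩ N⁺ G v ∣) ≤⟨ ∑-mono-≤ (λ v → *-monoʳ-≤ (𝟙 (lookup T v)) (∣T∩N⁺∣≤r v)) ⟩
  ∑[ v < n ] (𝟙 (lookup T v) * r)              ≡⟨ ∑𝟙*c≡c*∣p∣ T r ⟩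
  r * ∣ T ∣                                    ∎
  where
  open ≤-Reasoning
  ∣T∩N⁺∣≤r : ∀ v → ∣ T ∩ N⁺ G v ∣ ≤ r
  ∣T∩N⁺∣≤r v = ≤-trans (∣p∩q∣≤∣q∣ T (N⁺ G v)) (subst (_≤ r) (outdeg≡∣N⁺∣ G v) (Δ⁺≤r v))

maxIndeg⇒sparse : ∀ {n} (G : Digraph n) {r} → MaxIndeg≤ G r → Sparse G r
maxIndeg⇒sparse G Δ⁻≤r T = subst (_≤ _) (arcs-reverse G T) (maxOutdeg⇒sparse (reverse G) Δ⁻≤r T)

sparse⇒∑deg≤ : ∀ {n} (G : Digraph n) r → Sparse G r →
               ∀ T → ∑[ v < n ] (𝟙 (lookup T v) * ∣ T ∩ N G v ∣) ≤ 2 * r * ∣ T ∣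
sparse⇒∑deg≤ {n} G r sparse T = begin
  ∑[ v < n ] (𝟙 (lookup T v) * ∣ T ∩ N G v ∣)
    ≤⟨ ∑-mono-≤ (λ v → *-monoʳ-≤ (𝟙 (lookup T v)) (∣T∩N∣≤ v)) ⟩
  ∑[ v < n ] (𝟙 (lookup T v) * (∣ T ∩ N⁺ G v ∣ + ∣ T ∩ N⁻ G v ∣))
    ≡⟨ sum-cong-≗ (λ v → *-distribˡ-+ (𝟙 (lookup T v)) ∣ T ∩ N⁺ G v ∣ ∣ T ∩ N⁻ G v ∣) ⟩
  ∑[ v < n ] (𝟙 (lookup T v) * ∣ T ∩ N⁺ G v ∣ + 𝟙 (lookup T v) * ∣ T ∩ N⁻ G v ∣)
    ≡⟨ ∑-distrib-+ (λ v → 𝟙 (lookup T v) * ∣ T ∩ N⁺ G v ∣) (λ v → 𝟙 (lookup T v) * ∣ T ∩ N⁻ G v ∣) ⟩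
  ∑[ v < n ] (𝟙 (lookup T v) * ∣ T ∩ N⁺ G v ∣) + ∑[ v < n ] (𝟙 (lookup T v) * ∣ T ∩ N⁻ G v ∣)
    ≡⟨ cong₂ _+_ (arcs≡∑∣T∩N⁺∣ G T) (trans (sym (arcs-reverse G T)) (arcs≡∑∣T∩N⁺∣ (reverse G) T)) ⟨
  arcs G T + arcs G T
    ≤⟨ +-mono-≤ (sparse T) (sparse T) ⟩
  r * ∣ T ∣ + r * ∣ T ∣
    ≡⟨ cong (λ s → r * ∣ T ∣ + s * ∣ T ∣) (+-identityʳ r) ⟨
  r * ∣ T ∣ + (r + 0) * ∣ T ∣
    ≡⟨ *-distribʳ-+ ∣ T ∣ r (r + 0) ⟨
  2 * r * ∣ T ∣ ∎
  where
  open ≤-Reasoning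
  ∣T∩N∣≤ : ∀ v → ∣ T ∩ N G v ∣ ≤ ∣ T ∩ N⁺ G v ∣ + ∣ T ∩ N⁻ G v ∣
  ∣T∩N∣≤ v = subst (λ p → ∣ p ∣ ≤ ∣ T ∩ N⁺ G v ∣ + ∣ T ∩ N⁻ G v ∣)
                   (sym (∩-distribˡ-∪ T (N⁺ G v) (N⁻ G v)))
                   (∣p∪q∣≤∣p∣+∣q∣ (T ∩ N⁺ G v) (T ∩ N⁻ G v))

∃-below-average : ∀ {n} (T : Subset n) (d : Fin n → ℕ) {c} → Nonempty T →
                  ∑[ v < n ] (𝟙 (lookup T v) * d v) ≤ c * ∣ T ∣ → ∃[ v ] v ∈ T × d v ≤ c
∃-below-average {n} T d {c} (x , x∈T) ∑≤c∣T∣ with any? (λ v → v ∈? T ×-dec d v ≤? c)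
... | yes found = found
... | no  none  = contradiction ∑≤c∣T∣ (<⇒≱ (begin-strict
  c * ∣ T ∣                          <⟨ m<n+m (c * ∣ T ∣) (≤-<-trans z≤n (x∈p⇒∣p-x∣<∣p∣ x∈T)) ⟩
  suc c * ∣ T ∣                      ≡⟨ ∑𝟙*c≡c*∣p∣ T (suc c) ⟨
  ∑[ v < n ] (𝟙 (lookup T v) * suc c) ≤⟨ ∑-mono-≤ above ⟩
  ∑[ v < n ] (𝟙 (lookup T v) * d v)   ∎))
  where
  open ≤-Reasoning
  above : ∀ v → 𝟙 (lookup T v) * suc c ≤ 𝟙 (lookup T v) * d v
  above v with lookup T v in Tv
  ... | false = z≤n
  ... | true  = *-monoʳ-≤ 1 (≰⇒> λ dv≤c → none (v , lookup⇒[]= v T Tv , dv≤c))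

Independent-⁅⁆∪ : ∀ {n} (G : Digraph n) {v I} → Independent G I →
                  (∀ w → w ∈ I → adj G v w ≡ false × adj G w v ≡ false) → Independent G (⁅ v ⁆ ∪ I)
Independent-⁅⁆∪ G {v} {I} I-indep v-apart u w u∈ w∈ with x∈p∪q⁻ ⁅ v ⁆ I u∈ | x∈p∪q⁻ ⁅ v ⁆ I w∈
... | inj₁ u∈⁅v⁆ | inj₁ w∈⁅v⁆ rewrite x∈⁅y⁆⇒x≡y v u∈⁅v⁆ | x∈⁅y⁆⇒x≡y v w∈⁅v⁆ = loopless G v
... | inj₁ u∈⁅v⁆ | inj₂ w∈I   rewrite x∈⁅y⁆⇒x≡y v u∈⁅v⁆ = proj₁ (v-apart w w∈I)
... | inj₂ u∈I   | inj₁ w∈⁅v⁆ rewrite x∈⁅y⁆⇒x≡y v w∈⁅v⁆ = proj₂ (v-apart u u∈I)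
... | inj₂ u∈I   | inj₂ w∈I   = I-indep u w u∈I w∈I

record LargeIndependentSubset {n} (G : Digraph n) (k : ℕ) (T : Subset n) : Set where
  field
    I           : Subset n
    I⊆T         : I ⊆ T
    independent : Independent G I
    large       : ∣ T ∣ ≤ k * ∣ I ∣

module Greedy {n} (G : Digraph n) (r : ℕ) (sparse : Sparse G r) where

  k : ℕ
  k = 2 * r + 1

  closedN : Subset n → Fin n → Subset n
  closedN T v = ⁅ v ⁆ ∪ T ∩ N G v

  v∈closedN : ∀ T v → v ∈ closedN T v
  v∈closedN T v = x∈p∪q⁺ (inj₁ (x∈⁅x⁆ v))

  ∣closedN∣≤k : ∀ T v → ∣ T ∩ N G v ∣ ≤ 2 * r → ∣ closedN T v ∣ ≤ k
  ∣closedN∣≤k T v deg≤2r = begin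
    ∣ ⁅ v ⁆ ∪ T ∩ N G v ∣     ≤⟨ ∣p∪q∣≤∣p∣+∣q∣ ⁅ v ⁆ (T ∩ N G v) ⟩
    ∣ ⁅ v ⁆ ∣ + ∣ T ∩ N G v ∣ ≡⟨ cong (_+ ∣ T ∩ N G v ∣) (∣⁅x⁆∣≡1 v) ⟩
    suc ∣ T ∩ N G v ∣         ≤⟨ s≤s deg≤2r ⟩
    suc (2 * r)               ≡⟨ +-comm 1 (2 * r) ⟩
    k                         ∎
    where open ≤-Reasoning

  extend : ∀ {T} v → v ∈ T → ∣ T ∩ N G v ∣ ≤ 2 * r →
           LargeIndependentSubset G k (T ─ closedN T v) → LargeIndependentSubset G k T
  extend {T} v v∈T deg≤2r rest = record
    { I           = ⁅ v ⁆ ∪ I′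
    ; I⊆T         = I⊆T
    ; independent = Independent-⁅⁆∪ G I′-independent v-apart
    ; large       = large
    }
    where
    open LargeIndependentSubset rest
      renaming (I to I′; I⊆T to I′⊆T′; independent to I′-independent; large to I′-large)

    v∉I′ : v ∉ I′
    v∉I′ v∈I′ = x∈p─q⇒x∉q (I′⊆T′ v∈I′) (v∈closedN T v)

    v-apart : ∀ w → w ∈ I′ → adj G v w ≡ false × adj G w v ≡ false
    v-apart w w∈I′ = ∉N⇒nonadjacent G λ w∈N →
      x∈p─q⇒x∉q w∈T′ (x∈p∪q⁺ (inj₂ (x∈p∩q⁺ (p─q⊆p T (closedN T v) w∈T′ , w∈N))))
      where w∈T′ = I′⊆T′ w∈I′

    I⊆T : ⁅ v ⁆ ∪ I′ ⊆ T
    I⊆T u∈I with x∈p∪q⁻ ⁅ v ⁆ I′ u∈I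
    ... | inj₁ u∈⁅v⁆ rewrite x∈⁅y⁆⇒x≡y v u∈⁅v⁆ = v∈T
    ... | inj₂ u∈I′ = p─q⊆p T (closedN T v) (I′⊆T′ u∈I′)

    ∣I′∣<∣I∣ : ∣ I′ ∣ < ∣ ⁅ v ⁆ ∪ I′ ∣
    ∣I′∣<∣I∣ = ≤-<-trans (p⊆q⇒∣p∣≤∣q∣ I′⊆I-v) (x∈p⇒∣p-x∣<∣p∣ (x∈p∪q⁺ (inj₁ (x∈⁅x⁆ v))))
      where
      I′⊆I-v : I′ ⊆ (⁅ v ⁆ ∪ I′) - v
      I′⊆I-v u∈I′ = x∈p∧x≢y⇒x∈p-y (x∈p∪q⁺ (inj₂ u∈I′)) λ { refl → v∉I′ u∈I′ }

    large : ∣ T ∣ ≤ k * ∣ ⁅ v ⁆ ∪ I′ ∣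
    large = begin
      ∣ T ∣                                 ≤⟨ ∣p∣≤∣p─q∣+∣q∣ T (closedN T v) ⟩
      ∣ T ─ closedN T v ∣ + ∣ closedN T v ∣ ≤⟨ +-mono-≤ I′-large (∣closedN∣≤k T v deg≤2r) ⟩
      k * ∣ I′ ∣ + k                        ≡⟨ +-comm (k * ∣ I′ ∣) k ⟩
      k + k * ∣ I′ ∣                        ≡⟨ *-suc k ∣ I′ ∣ ⟨
      k * suc ∣ I′ ∣                        ≤⟨ *-monoʳ-≤ k ∣I′∣<∣I∣ ⟩
      k * ∣ ⁅ v ⁆ ∪ I′ ∣                    ∎
      where open ≤-Reasoning

  greedy : ∀ T → Acc _⊂_ T → LargeIndependentSubset G k T
  greedy T (acc smaller) with nonempty? T
  ... | no T-empty = record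
    { I           = ⊥
    ; I⊆T         = ⊥⊆
    ; independent = λ _ _ u∈⊥ → contradiction u∈⊥ ∉⊥
    ; large       = ≤-trans (≤-reflexive (trans (cong ∣_∣ (Empty-unique T-empty)) (∣⊥∣≡0 n))) z≤n
    }
  ... | yes T-nonempty
    with ∃-below-average T (λ v → ∣ T ∩ N G v ∣) T-nonempty (sparse⇒∑deg≤ G r sparse T)
  ...   | v , v∈T , deg≤2r = extend v v∈T deg≤2r (greedy (T ─ closedN T v) (smaller T′⊂T))
    where
    T′⊂T : T ─ closedN T v ⊂ T
    T′⊂T = p∩q≢∅⇒p─q⊂p T (closedN T v) (v , x∈p∩q⁺ (v∈T , v∈closedN T v))

sparse⇒largeIndependentSubset : ∀ {n} (G : Digraph n) r → Sparse G r →
                                ∀ T → LargeIndependentSubset G (2 * r + 1) T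
sparse⇒largeIndependentSubset G r sparse T = Greedy.greedy G r sparse T (⊂-wellFounded T)

∖-independent : ∀ {n} (D D' : Digraph n) {S I : Subset n} →
                Independent (D ∖ D') S → I ⊆ S → Independent D' I → Independent D I
∖-independent D D' S-indep I⊆S I-indep u w u∈I w∈I = begin
  adj D u w                    ≡⟨ ∧-identityʳ (adj D u w) ⟨
  adj D u w ∧ not false        ≡⟨ cong (λ b → adj D u w ∧ not b) (I-indep u w u∈I w∈I) ⟨
  adj D u w ∧ not (adj D' u w) ≡⟨ S-indep u w (I⊆S u∈I) (I⊆S w∈I) ⟩
  false                        ∎
  where open ≡-Reasoning

lemma2p3 : ∀ (n : ℕ) (D D' : Digraph n) (r a b : ℕ) →
    (MaxOutdeg≤ D' r ⊎ MaxIndeg≤ D' r) →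
    IsIndependenceNumber (D ∖ D') a →
    IsIndependenceNumber D b →
    a ≤ (2 * r + 1) * b
lemma2p3 n D D' r a b Δ≤r ((S , S-independent , ∣S∣≡a) , _) (_ , α-maximal) = begin
  a                   ≡⟨ ∣S∣≡a ⟨
  ∣ S ∣               ≤⟨ large ⟩
  (2 * r + 1) * ∣ I ∣ ≤⟨ *-monoʳ-≤ (2 * r + 1) (α-maximal I I-independent) ⟩
  (2 * r + 1) * b     ∎
  where
  open ≤-Reasoning
  D'-sparse : Sparse D' r
  D'-sparse = [ maxOutdeg⇒sparse D' , maxIndeg⇒sparse D' ] Δ≤r
  open LargeIndependentSubset (sparse⇒largeIndependentSubset D' r D'-sparse S)
  I-independent : Independent D I
  I-independent = ∖-independent D D' S-independent I⊆T independent
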